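{- Let $(F_n)_{n\in\mathbb{N}}$ be a linear-like semiring family of graphs, and let $k,\ell,n\in\mathbb{N}$. If there is a graph homomorphism $F_k+F_\ell\to F_n$, then $k+\ell\le n$.
   Context: Graphs are undirected simple graphs, possibly infinite; $\omega$ is the clique number. The join $G+H$ is the disjoint union with all edges between the two parts added; the disjunctive product $G\ast H$ has vertex set $V(G)\times V(H)$ with $(v,w)\sim(v',w')$ iff $v\sim v'$ or $w\sim w'$. A semiring family is a sequence $(F_n)_{n\in\mathbb{N}}$ with $F_0=\emptyset$, $F_1\ne\emptyset$, and graph homomorphisms $F_n+F_m\to F_{n+m}$, $F_n\ast F_m\to F_{nm}$. For $S\subseteq V(G)$, $S^\perp$ is the set of vertices adjacent to all vertices of $S$; $S$ is a flat if $S^{\perp\perp}=S$; $\mathrm{rk}(S)=\omega(S^{\perp\perp})$. $(F_n)$ is linear-like if for every $n$ and every flat $S\subseteq V(F_n)$, the induced subgraph on $S$ is homomorphically equivalent to $F_{\mathrm{rk}(S)}$. -}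

module Defs where

open import Data.Nat using (ℕ; _+_; _*_; _≤_)
open import Data.Fin using (Fin)
open import Data.Product using (Σ; _×_; _,_; proj₁)
open import Data.Sum using (_⊎_; inj₁; inj₂)
open import Data.Unit using (⊤)
open import Data.Empty using (⊥)
open import Relation.Nullary using (¬_)
open import Relation.Binary.PropositionalEquality using (_≡_)

record Graph : Set₁ where
  field
    V     : Set
    Adj   : V → V → Set
    sym   : ∀ {x y} → Adj x y → Adj y x
    irrefl : ∀ {x} → ¬ Adj x x
open Graph public

record Hom (G H : Graph) : Set where
  field
    fun   : V G → V H
    preserves : ∀ {x y} → Adj G x y → Adj H (fun x) (fun y)
open Hom public

HomEquiv : Graph → Graph → Set
HomEquiv G H = Hom G H × Hom H G

_⊕_ : Graph → Graph → Graph
G ⊕ H = record { V = V G ⊎ V H ; Adj = adj ; sym = λ {x} {y} → s {x} {y} ; irrefl = λ {x} → ir {x} }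
  where
  adj : V G ⊎ V H → V G ⊎ V H → Set
  adj (inj₁ x) (inj₁ y) = Adj G x y
  adj (inj₂ x) (inj₂ y) = Adj H x y
  adj (inj₁ _) (inj₂ _) = ⊤
  adj (inj₂ _) (inj₁ _) = ⊤
  s : ∀ {x y} → adj x y → adj y x
  s {inj₁ x} {inj₁ y} a = sym G a
  s {inj₂ x} {inj₂ y} a = sym H a
  s {inj₁ _} {inj₂ _} a = a
  s {inj₂ _} {inj₁ _} a = a
  ir : ∀ {x} → ¬ adj x x
  ir {inj₁ x} = irrefl G
  ir {inj₂ x} = irrefl H

_⊛_ : Graph → Graph → Graph
G ⊛ H = record { V = V G × V H ; Adj = adj ; sym = λ {x} {y} → s {x} {y} ; irrefl = λ {x} → ir {x} }
  where
  adj : V G × V H → V G × V H → Set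
  adj (v , w) (v' , w') = Adj G v v' ⊎ Adj H w w'
  s : ∀ {x y} → adj x y → adj y x
  s {_ , _} {_ , _} (inj₁ a) = inj₁ (sym G a)
  s {_ , _} {_ , _} (inj₂ a) = inj₂ (sym H a)
  ir : ∀ {x} → ¬ adj x x
  ir {_ , _} (inj₁ a) = irrefl G a
  ir {_ , _} (inj₂ a) = irrefl H a

Subset : Graph → Set₁
Subset G = V G → Set

Induced : (G : Graph) → Subset G → Graph
Induced G S = record
  { V = Σ (V G) S
  ; Adj = λ x y → Adj G (proj₁ x) (proj₁ y)
  ; sym = sym G
  ; irrefl = irrefl G }

_^⊥ : {G : Graph} → Subset G → Subset G
_^⊥ {G} S v = ∀ u → S u → Adj G v u

IsFlat : (G : Graph) → Subset G → Set
IsFlat G S = ∀ v → ((_^⊥ {G} (_^⊥ {G} S)) v → S v) × (S v → (_^⊥ {G} (_^⊥ {G} S)) v)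

HasClique : Graph → ℕ → Set
HasClique G r = Σ (Fin r → V G) λ f → ∀ i j → ¬ i ≡ j → Adj G (f i) (f j)

CliqueNumber : Graph → ℕ → Set
CliqueNumber G r = HasClique G r × (∀ m → HasClique G m → m ≤ r)

record IsSemiringFamily (F : ℕ → Graph) : Set where
  field
    F0-empty : ¬ V (F 0)
    F1-nonempty : V (F 1)
    join-hom : ∀ n m → Hom (F n ⊕ F m) (F (n + m))
    prod-hom : ∀ n m → Hom (F n ⊛ F m) (F (n * m))

IsLinearLike : (ℕ → Graph) → Set₁
IsLinearLike F = ∀ n (S : Subset (F n)) → IsFlat (F n) S →
  Σ ℕ λ r → CliqueNumber (Induced (F n) (_^⊥ {F n} (_^⊥ {F n} S))) r
          × HomEquiv (Induced (F n) S) (F r)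

-- Since F₁ is nonempty, iterating F₁ + Fₙ → Fₙ₊₁ puts an n-clique in Fₙ.
-- The whole vertex set of Fₙ is a flat, so linearity gives ω(Fₙ) = r with Fₙ
-- homomorphically equivalent to F_r, and r ≥ n. Writing r = n + d, an r-clique of Fₙ
-- joined with a d-clique of F_d lands in F_{n+d} = F_r → Fₙ, so r + d ≤ r, d = 0 and
-- ω(Fₙ) = n. Finally a (k+l)-clique of F_k + F_l maps into Fₙ.
module Submission where

open import Defs
open import Data.Nat using (ℕ; _+_; _≤_; zero; suc)
open import Data.Nat.Properties using (+-cancelˡ-≤; +-identityʳ; n≤0⇒n≡0; m≤n⇒∃[o]m+o≡n)
open import Data.Fin using (Fin; splitAt; join) renaming (zero to fzero)
open import Data.Fin.Properties using (join-splitAt)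
open import Data.Product using (Σ; _×_; _,_; proj₁; proj₂)
open import Data.Sum using (_⊎_; inj₁; inj₂; [_,_]′)
open import Data.Unit using (⊤; tt)
open import Data.Empty using (⊥-elim)
open import Relation.Nullary using (¬_)
open import Function using (_∘_)
open import Relation.Binary.PropositionalEquality using (_≡_; refl; cong; subst; module ≡-Reasoning)
  renaming (sym to ≡-sym)

Hom-trans : ∀ {G H K} → Hom G H → Hom H K → Hom G K
Hom-trans h k = record { fun = fun k ∘ fun h ; preserves = preserves k ∘ preserves h }

Induced-proj₁ : ∀ G (S : Subset G) → Hom (Induced G S) G
Induced-proj₁ G S = record { fun = proj₁ ; preserves = λ a → a }

Induced-total : ∀ G (S : Subset G) → (∀ v → S v) → Hom G (Induced G S)
Induced-total G S all = record { fun = λ v → v , all v ; preserves = λ a → a }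

HasClique-map : ∀ {G H m} → Hom G H → HasClique G m → HasClique H m
HasClique-map h (f , adj) = fun h ∘ f , λ i j i≢j → preserves h (adj i j i≢j)

HasClique-⊕ : ∀ {G H a b} → HasClique G a → HasClique H b → HasClique (G ⊕ H) (a + b)
HasClique-⊕ {G} {H} {a} {b} (f , adjG) (g , adjH) =
  c ∘ splitAt a , λ i j i≢j → c-adj (splitAt a i) (splitAt a j) (i≢j ∘ splitAt-injective)
  where
  c : Fin a ⊎ Fin b → V (G ⊕ H)
  c = [ inj₁ ∘ f , inj₂ ∘ g ]′

  c-adj : ∀ p q → ¬ p ≡ q → Adj (G ⊕ H) (c p) (c q)
  c-adj (inj₁ x) (inj₁ y) p≢q = adjG x y (p≢q ∘ cong inj₁)
  c-adj (inj₂ x) (inj₂ y) p≢q = adjH x y (p≢q ∘ cong inj₂)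
  c-adj (inj₁ _) (inj₂ _) _   = tt
  c-adj (inj₂ _) (inj₁ _) _   = tt

  splitAt-injective : ∀ {i j} → splitAt a i ≡ splitAt a j → i ≡ j
  splitAt-injective {i} {j} eq = begin
    i                       ≡⟨ join-splitAt a b i ⟨
    join a b (splitAt a i)  ≡⟨ cong (join a b) eq ⟩
    join a b (splitAt a j)  ≡⟨ join-splitAt a b j ⟩
    j                       ∎
    where open ≡-Reasoning

full : (G : Graph) → Subset G
full G _ = ⊤

full-isFlat : (G : Graph) → IsFlat G (full G)
full-isFlat G v = (λ _ → tt) , λ _ u u∈full⊥ → ⊥-elim (irrefl G (u∈full⊥ u tt))

CliqueNumber-Induced-total : ∀ G (S : Subset G) → (∀ v → S v) → ∀ {r} →
  CliqueNumber (Induced G S) r → CliqueNumber G r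
CliqueNumber-Induced-total G S all (clique , maximal) =
  HasClique-map (Induced-proj₁ G S) clique , λ m → maximal m ∘ HasClique-map (Induced-total G S all)

module SemiringFamily {F : ℕ → Graph} (isSemiringFamily : IsSemiringFamily F) where
  open IsSemiringFamily isSemiringFamily

  HasClique-F : ∀ n → HasClique (F n) n
  HasClique-F zero    = (λ ()) , λ ()
  HasClique-F (suc n) = HasClique-map (join-hom 1 n) (HasClique-⊕ point (HasClique-F n))
    where
    point : HasClique (F 1) 1
    point = (λ _ → F1-nonempty) , λ { fzero fzero 0≢0 → ⊥-elim (0≢0 refl) }

  CliqueNumber-F : ∀ {n r} → CliqueNumber (F n) r → Hom (F r) (F n) → r ≡ n
  CliqueNumber-F {n} {r} (clique , maximal) F_r→F_n with m≤n⇒∃[o]m+o≡n (maximal n (HasClique-F n))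
  ... | d , n+d≡r = begin
    r      ≡⟨ n+d≡r ⟨
    n + d  ≡⟨ cong (n +_) d≡0 ⟩
    n + 0  ≡⟨ +-identityʳ n ⟩
    n      ∎
    where
    open ≡-Reasoning
    r+d≤r : r + d ≤ r
    r+d≤r = maximal (r + d)
      (HasClique-map (Hom-trans (join-hom n d) (subst (λ s → Hom (F s) (F n)) (≡-sym n+d≡r) F_r→F_n))
        (HasClique-⊕ clique (HasClique-F d)))
    d≡0 : d ≡ 0
    d≡0 = n≤0⇒n≡0 (+-cancelˡ-≤ r d 0 (subst (r + d ≤_) (≡-sym (+-identityʳ r)) r+d≤r))

  module LinearLike (isLinearLike : IsLinearLike F) where

    rank-full : ∀ n → Σ ℕ λ r → CliqueNumber (F n) r × Hom (F r) (F n)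
    rank-full n with isLinearLike n (full (F n)) (full-isFlat (F n))
    ... | r , ω≡r , (_ , F_r→full) =
      r , CliqueNumber-Induced-total (F n) full⊥⊥ full⊥⊥-total ω≡r ,
      Hom-trans F_r→full (Induced-proj₁ (F n) (full (F n)))
      where
      full⊥⊥ : Subset (F n)
      full⊥⊥ = _^⊥ {F n} (_^⊥ {F n} (full (F n)))
      full⊥⊥-total : ∀ v → full⊥⊥ v
      full⊥⊥-total v = proj₂ (full-isFlat (F n) v) tt

    HasClique-F-bound : ∀ n m → HasClique (F n) m → m ≤ n
    HasClique-F-bound n m clique with rank-full n
    ... | r , ω≡r , F_r→F_n = subst (m ≤_) (CliqueNumber-F ω≡r F_r→F_n) (proj₂ ω≡r m clique)

lemma4p8 : (F : ℕ → Graph) → IsSemiringFamily F → IsLinearLike F →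
    (k l n : ℕ) → Hom (F k ⊕ F l) (F n) → k + l ≤ n
lemma4p8 F isSemiringFamily isLinearLike k l n h =
  HasClique-F-bound n (k + l) (HasClique-map h (HasClique-⊕ (HasClique-F k) (HasClique-F l)))
  where
  open SemiringFamily isSemiringFamily
  open LinearLike isLinearLike
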